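{- Let $k\ge2$ and let $P=P_1\,u\,P_2\,d\,u\,P_3\,d\cdots u\,P_k\,d$ where $P_1,\dots,P_k$ are (possibly empty) Dyck paths. Then $\operatorname{mir}(P)=\operatorname{mir}(P_k)\,u\,\operatorname{mir}(P_{k-1})\,u\cdots u\,\operatorname{mir}(P_1)\,d^{k-1}$.
   Context: A Dyck path is a (possibly empty) word in $u$ and $d$ with equally many $u$ and $d$ and every prefix having at least as many $u$ as $d$. Every nonempty Dyck path $D$ can be written uniquely as $D=D_1uD_2d$ with $D_1,D_2$ (possibly empty) Dyck paths. The map $\operatorname{mir}$ on Dyck paths is defined recursively by $\operatorname{mir}(\epsilon)=\epsilon$ for the empty path $\epsilon$, and $\operatorname{mir}(D_1uD_2d)=\operatorname{mir}(D_2)\,u\,\operatorname{mir}(D_1)\,d$. -}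

module Defs where

open import Data.List using (List; []; _∷_; _++_; replicate; concatMap; foldr)
open import Data.Nat using (ℕ)

data Step : Set where
  u d : Step

-- Dyck paths via their unique first-return decomposition D = D₁ u D₂ d.
-- (Every Dyck word arises as 'word D' for exactly one D : Dyck.)
data Dyck : Set where
  ε    : Dyck
  node : Dyck → Dyck → Dyck

word : Dyck → List Step
word ε          = []
word (node a b) = word a ++ (u ∷ word b ++ d ∷ [])

mir : Dyck → Dyck
mir ε          = ε
mir (node a b) = node (mir b) (mir a)

lhsWord : Dyck → List Dyck → List Step
lhsWord P₁ rest = word P₁ ++ concatMap (λ Q → u ∷ word Q ++ d ∷ []) rest

joinU : Dyck → List Dyck → List Step
joinU Q₁ []       = word Q₁
joinU Q₁ (Q ∷ Qs) = word Q₁ ++ (u ∷ joinU Q Qs)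

module Submission where

-- Written as trees, P₁ u P₂ d ⋯ u P_k d is the left comb node(⋯node(node P₁ P₂)P₃⋯)P_k,
-- since word (node a b) = word a u word b d. As mir swaps the two subtrees of every node
-- and recurses, it turns this left comb into the right comb
-- node (mir P_k) (node (mir P_{k-1}) ⋯ (node (mir P₂) (mir P₁))), whose word is
-- mir(P_k) u ⋯ u mir(P₂) u mir(P₁) followed by one d per node. The only non-structural
-- ingredient is that word is injective, which follows from a left-inverse parser.

open import Defs
open import Data.List using (List; []; _∷_; _++_; _∷ʳ_; replicate; reverse; map; length; foldl; foldr; concatMap)
open import Data.List.Properties using (++-assoc; ++-identityʳ; foldr-++; unfold-reverse; length-reverse; length-map)
open import Data.Nat using (zero; suc; _∸_; _≥_)
open import Function using (_∘′_)
open import Relation.Binary.PropositionalEquality using (_≡_; refl; sym; trans; cong; module ≡-Reasoning)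
open ≡-Reasoning

-- A stack machine: the tree argument is the path read so far at the current height,
-- and the stack holds, for each pending u, the path read before it.
parseWith : List Step → Dyck → List Dyck → Dyck
parseWith []      t s       = t
parseWith (u ∷ w) t s       = parseWith w ε (t ∷ s)
parseWith (d ∷ w) t []      = t
parseWith (d ∷ w) t (a ∷ s) = parseWith w (node a t) s

parse : List Step → Dyck
parse w = parseWith w ε []

parseWith-word : ∀ D w s → parseWith (word D ++ w) ε s ≡ parseWith w D s
parseWith-word ε          w s = refl
parseWith-word (node a b) w s = begin
  parseWith ((word a ++ u ∷ word b ++ d ∷ []) ++ w) ε s
    ≡⟨ cong (λ v → parseWith v ε s) (++-assoc (word a) _ w) ⟩
  parseWith (word a ++ u ∷ (word b ++ d ∷ []) ++ w) ε s
    ≡⟨ parseWith-word a _ s ⟩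
  parseWith ((word b ++ d ∷ []) ++ w) ε (a ∷ s)
    ≡⟨ cong (λ v → parseWith v ε (a ∷ s)) (++-assoc (word b) _ w) ⟩
  parseWith (word b ++ d ∷ w) ε (a ∷ s)
    ≡⟨ parseWith-word b _ _ ⟩
  parseWith w (node a b) s ∎

parse-word : ∀ D → parse (word D) ≡ D
parse-word D = begin
  parse (word D)            ≡⟨ cong parse (sym (++-identityʳ (word D))) ⟩
  parse (word D ++ [])      ≡⟨ parseWith-word D [] [] ⟩
  D                         ∎

word-injective : ∀ {D E} → word D ≡ word E → D ≡ E
word-injective {D} {E} eq = begin
  D                ≡⟨ sym (parse-word D) ⟩
  parse (word D)   ≡⟨ cong parse eq ⟩
  parse (word E)   ≡⟨ parse-word E ⟩
  E                ∎

word-foldl-node : ∀ t Qs →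
  word (foldl node t Qs) ≡ word t ++ concatMap (λ Q → u ∷ word Q ++ d ∷ []) Qs
word-foldl-node t []       = sym (++-identityʳ (word t))
word-foldl-node t (Q ∷ Qs) = begin
  word (foldl node (node t Q) Qs)      ≡⟨ word-foldl-node (node t Q) Qs ⟩
  (word t ++ step Q) ++ steps Qs       ≡⟨ ++-assoc (word t) (step Q) (steps Qs) ⟩
  word t ++ step Q ++ steps Qs         ∎
  where
    step : Dyck → List Step
    step Q = u ∷ word Q ++ d ∷ []
    steps : List Dyck → List Step
    steps = concatMap step

mir-foldl-node : ∀ t Qs → mir (foldl node t Qs) ≡ foldr node (mir t) (reverse (map mir Qs))
mir-foldl-node t []       = refl
mir-foldl-node t (Q ∷ Qs) = begin
  mir (foldl node (node t Q) Qs)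
    ≡⟨ mir-foldl-node (node t Q) Qs ⟩
  foldr node (node (mir Q) (mir t)) (reverse (map mir Qs))
    ≡⟨ sym (foldr-++ node (mir t) (reverse (map mir Qs)) (mir Q ∷ [])) ⟩
  foldr node (mir t) (reverse (map mir Qs) ∷ʳ mir Q)
    ≡⟨ cong (foldr node (mir t)) (sym (unfold-reverse (mir Q) (map mir Qs))) ⟩
  foldr node (mir t) (reverse (mir Q ∷ map mir Qs)) ∎

replicate-∷ʳ : ∀ {A : Set} (x : A) n → replicate n x ∷ʳ x ≡ x ∷ replicate n x
replicate-∷ʳ x zero    = refl
replicate-∷ʳ x (suc n) = cong (x ∷_) (replicate-∷ʳ x n)

++-u-d-replicate : ∀ a {w} J n → w ≡ J ++ replicate n d →
  a ++ u ∷ w ++ d ∷ [] ≡ (a ++ u ∷ J) ++ replicate (suc n) d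
++-u-d-replicate a {w} J n eq = begin
  a ++ u ∷ w ++ d ∷ []                  ≡⟨ cong (λ v → a ++ u ∷ v ++ d ∷ []) eq ⟩
  a ++ u ∷ (J ++ R) ++ d ∷ []           ≡⟨ cong (λ v → a ++ u ∷ v) (++-assoc J R (d ∷ [])) ⟩
  a ++ u ∷ J ++ R ∷ʳ d                  ≡⟨ cong (λ v → a ++ u ∷ J ++ v) (replicate-∷ʳ d n) ⟩
  a ++ (u ∷ J) ++ d ∷ R                 ≡⟨ sym (++-assoc a (u ∷ J) (d ∷ R)) ⟩
  (a ++ u ∷ J) ++ d ∷ R                 ∎
  where
    R = replicate n d

word-foldr-node : ∀ xs y {z zs} → xs ∷ʳ y ≡ z ∷ zs →
  word (foldr node y xs) ≡ joinU z zs ++ replicate (length xs) d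
word-foldr-node []            y refl = sym (++-identityʳ (word y))
word-foldr-node (x ∷ [])      y refl =
  ++-u-d-replicate (word x) (word y) 0 (word-foldr-node [] y refl)
word-foldr-node (x ∷ x′ ∷ xs) y refl =
  ++-u-d-replicate (word x) _ (length (x′ ∷ xs)) (word-foldr-node (x′ ∷ xs) y refl)

lemma4p7 : (P₁ : Dyck) (rest : List Dyck) → length (P₁ ∷ rest) ≥ 2 →
    (P : Dyck) → word P ≡ lhsWord P₁ rest →
    (Pk : Dyck) (revInit : List Dyck) → reverse (map mir (P₁ ∷ rest)) ≡ Pk ∷ revInit →
    word (mir P) ≡ joinU Pk revInit ++ replicate (length (P₁ ∷ rest) ∸ 1) d
lemma4p7 P₁ rest _ P wordP Pk revInit revPs = begin
  word (mir P)
    ≡⟨ cong (word ∘′ mir) P-comb ⟩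
  word (mir (foldl node P₁ rest))
    ≡⟨ cong word (mir-foldl-node P₁ rest) ⟩
  word (foldr node (mir P₁) xs)
    ≡⟨ word-foldr-node xs (mir P₁) (trans (sym (unfold-reverse (mir P₁) (map mir rest))) revPs) ⟩
  joinU Pk revInit ++ replicate (length xs) d
    ≡⟨ cong (λ n → joinU Pk revInit ++ replicate n d) (trans (length-reverse (map mir rest)) (length-map mir rest)) ⟩
  joinU Pk revInit ++ replicate (length rest) d ∎
  where
    xs = reverse (map mir rest)
    P-comb : P ≡ foldl node P₁ rest
    P-comb = word-injective (trans wordP (sym (word-foldl-node P₁ rest)))
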